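{- Let $n\ge1$ and let $(a_1,a_2,a_3,a_4)\in\mathbb H(\mathbb Z_{2^n})$. Each coordinate $a_i$ is either a unit of $\mathbb Z_{2^n}$ (an odd residue) or a zero-divisor of $\mathbb Z_{2^n}$ (an even residue, including $0$). Consider the five cases: (i) all four coordinates are zero-divisors of $\mathbb Z_{2^n}$; (ii) all four coordinates are units of $\mathbb Z_{2^n}$; (iii) exactly two coordinates are units and two are zero-divisors; (iv) exactly three coordinates are units and one is a zero-divisor; (v) exactly one coordinate is a unit and three are zero-divisors. Every element of $\mathbb H(\mathbb Z_{2^n})$ falls into exactly one of these cases. The elements in cases (i), (ii) and (iii) are zero-divisors of $\mathbb H(\mathbb Z_{2^n})$ (here $(0,0,0,0)$ is counted in case (i)). The elements in cases (iv) and (v) are units of $\mathbb H(\mathbb Z_{2^n})$.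
   Context: $\mathbb H(\mathbb Z_{2^n})$ is the ring of Hamilton quaternions over $\mathbb Z_{2^n}$. Its elements are $a_1+a_2i+a_3j+a_4k$ with $a_i\in\mathbb Z_{2^n}$, written $(a_1,a_2,a_3,a_4)$. Addition is coordinatewise, and multiplication is determined by distributivity, scalars commuting with $i,j,k$, and $i^2=j^2=k^2=-1$, $ij=-ji=k$, $jk=-kj=i$, $ki=-ik=j$. -}

module Defs where

open import Data.Nat as ℕ using (ℕ; suc; _^_; NonZero)
open import Data.Nat.Properties using (m^n≢0)
open import Data.Integer as ℤ using (ℤ; +_)
open import Data.Integer.DivMod using (_modℕ_; n%ℕd<d)
open import Data.Fin as Fin using (Fin; toℕ; fromℕ<; zero; suc)
open import Data.Fin.Subset using (Subset; _∈_; _∉_; ∣_∣)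
open import Data.Product using (Σ; ∃; _×_)
open import Data.Sum using (_⊎_)
open import Relation.Binary.PropositionalEquality using (_≡_; _≢_)

mod : ℕ → ℕ
mod n = 2 ^ n

mod-nonZero : ∀ n → NonZero (mod n)
mod-nonZero n = m^n≢0 2 n

-- ℤ_{2^n}, elements represented by their canonical residues 0 … 2^n - 1.
-- (wrapped in a record so that n can be inferred from the type)
record Zmod (n : ℕ) : Set where
  constructor ⟨_⟩
  field
    val : Fin (mod n)
open Zmod public

reduce : (n : ℕ) → ℤ → Zmod n
reduce n z = ⟨ fromℕ< (n%ℕd<d z (mod n) {{mod-nonZero n}}) ⟩

lift : ∀ {n} → Zmod n → ℤ
lift a = + toℕ (val a)

0ᶻ 1ᶻ : ∀ {n} → Zmod n
0ᶻ {n} = reduce n (+ 0)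
1ᶻ {n} = reduce n (+ 1)

_*ᶻ_ : ∀ {n} → Zmod n → Zmod n → Zmod n
_*ᶻ_ {n} a b = reduce n (lift a ℤ.* lift b)

IsUnitᶻ : ∀ {n} → Zmod n → Set
IsUnitᶻ a = ∃ λ b → a *ᶻ b ≡ 1ᶻ

IsZeroDivisorᶻ : ∀ {n} → Zmod n → Set
IsZeroDivisorᶻ a = ∃ λ b → b ≢ 0ᶻ × a *ᶻ b ≡ 0ᶻ

-- Hamilton quaternions over ℤ_{2^n}: a₁ + a₂ i + a₃ j + a₄ k.
record ℍ (n : ℕ) : Set where
  constructor quat
  field
    a₁ a₂ a₃ a₄ : Zmod n
open ℍ public

coord : ∀ {n} → ℍ n → Fin 4 → Zmod n
coord q zero = a₁ q
coord q (suc zero) = a₂ q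
coord q (suc (suc zero)) = a₃ q
coord q (suc (suc (suc zero))) = a₄ q

0ᴴ 1ᴴ : ∀ {n} → ℍ n
0ᴴ = quat 0ᶻ 0ᶻ 0ᶻ 0ᶻ
1ᴴ = quat 1ᶻ 0ᶻ 0ᶻ 0ᶻ

-- Quaternion multiplication (i² = j² = k² = -1, ij = k, jk = i, ki = j),
-- computed in ℤ and reduced mod 2^n.
_*ᴴ_ : ∀ {n} → ℍ n → ℍ n → ℍ n
_*ᴴ_ {n} (quat x₁ x₂ x₃ x₄) (quat y₁ y₂ y₃ y₄) =
  quat (reduce n (a ℤ.* b ℤ.- c ℤ.* d ℤ.- e ℤ.* f ℤ.- g ℤ.* h))
       (reduce n (a ℤ.* d ℤ.+ c ℤ.* b ℤ.+ e ℤ.* h ℤ.- g ℤ.* f))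
       (reduce n (a ℤ.* f ℤ.- c ℤ.* h ℤ.+ e ℤ.* b ℤ.+ g ℤ.* d))
       (reduce n (a ℤ.* h ℤ.+ c ℤ.* f ℤ.- e ℤ.* d ℤ.+ g ℤ.* b))
  where
  a = lift x₁ ; c = lift x₂ ; e = lift x₃ ; g = lift x₄
  b = lift y₁ ; d = lift y₂ ; f = lift y₃ ; h = lift y₄

IsUnitᴴ : ∀ {n} → ℍ n → Set
IsUnitᴴ x = ∃ λ y → (x *ᴴ y ≡ 1ᴴ) × (y *ᴴ x ≡ 1ᴴ)

IsZeroDivisorᴴ : ∀ {n} → ℍ n → Set
IsZeroDivisorᴴ x = ∃ λ y → y ≢ 0ᴴ × ((x *ᴴ y ≡ 0ᴴ) ⊎ (y *ᴴ x ≡ 0ᴴ))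

HasUnitCount : ∀ {n} → ℍ n → ℕ → Set
HasUnitCount q k =
  Σ (Subset 4) λ S → (∣ S ∣ ≡ k) ×
    ((i : Fin 4) → (i ∈ S → IsUnitᶻ (coord q i)) × (i ∉ S → IsZeroDivisorᶻ (coord q i)))

case-i case-ii case-iii case-iv case-v : ∀ {n} → ℍ n → Set
case-i   q = HasUnitCount q 0
case-ii  q = HasUnitCount q 4
case-iii q = HasUnitCount q 2
case-iv  q = HasUnitCount q 3
case-v   q = HasUnitCount q 1

module Submission where

-- The norm N(q) = a₁² + a₂² + a₃² + a₄² satisfies q q̄ = q̄ q = N(q), and since odd squares
-- are odd and even squares even, N(q) is congruent modulo 2 to the number of odd coordinates.
-- In ℤ_{2^n} the odd residues are the units (if a u ≡ 1 mod 2^k, squaring gives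
-- a u (a u) ≡ 1 mod 2^(k+1)) and the even residues are the zero-divisors (killed by 2^(n-1)).
-- If N(q) is odd it is invertible modulo 2^n and N(q)⁻¹ q̄ inverts q.  If N(q) is even,
-- 2^(n-1) q̄ annihilates q; should it vanish, every coordinate of q is even and 2^(n-1)
-- itself annihilates q.

open import Defs
open import Level using (0ℓ)
open import Data.Nat as ℕ using (ℕ; zero; suc; _≤_; _≥_; s≤s; z≤n; NonZero)
import Data.Nat.Properties as ℕ
import Data.Nat.Divisibility as ℕ
open import Data.Integer as ℤ using (ℤ; +_; 0ℤ; 1ℤ; _+_; _*_; _-_; -_)
import Data.Integer.Properties as ℤ
open import Data.Integer.Divisibility.Signed
open import Data.Integer.DivMod using (_%ℕ_; _/ℕ_; n%ℕd<d; a≡a%ℕn+[a/ℕn]*n)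
open import Data.Integer.Tactic.RingSolver using (solve-∀)
open import Data.Fin as Fin using (Fin)
import Data.Fin.Properties as Fin
open import Data.Fin.Patterns using (0F; 1F; 2F; 3F)
open import Data.Fin.Subset using (Subset; Side; inside; outside; _∈_; _∉_; ∣_∣)
open import Data.Fin.Subset.Properties using (∣p∣≤n)
open import Data.Vec using ([]; _∷_; lookup; foldr′; here; there)
open import Data.Vec.Properties using ([]=⇒lookup; lookup⇒[]=)
open import Data.Product using (Σ; ∃; _×_; _,_; proj₁; proj₂)
open import Data.Sum using (_⊎_; inj₁; inj₂)
open import Data.Empty using (⊥-elim)
open import Function using (_∘_)
open import Relation.Nullary using (¬_; Dec; yes; no)
open import Relation.Nullary.Decidable using (map′; _×-dec_)
open import Relation.Binary using (Setoid; DecidableEquality)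
import Relation.Binary.Reasoning.Setoid as SetoidReasoning
open import Relation.Binary.PropositionalEquality

infix 4 _≡_[mod_]

-- A record rather than the bare m ∣ a - b, so that a, b and m can be inferred from the type.
record _≡_[mod_] (a b m : ℤ) : Set where
  constructor congruent
  field m∣a-b : m ∣ a - b

module _ {m : ℤ} where

  ≡[mod]-reflexive : ∀ {a b} → a ≡ b → a ≡ b [mod m ]
  ≡[mod]-reflexive {a} refl = congruent (divides 0ℤ (trans (ℤ.+-inverseʳ a) (sym (ℤ.*-zeroˡ m))))

  ≡[mod]-refl : ∀ {a} → a ≡ a [mod m ]
  ≡[mod]-refl {a} = ≡[mod]-reflexive {a} refl

  ≡[mod]-sym : ∀ {a b} → a ≡ b [mod m ] → b ≡ a [mod m ]
  ≡[mod]-sym {a} {b} (congruent a≡b) = congruent (subst (m ∣_) (flip a b) (∣m⇒∣-m a≡b))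
    where
    flip : ∀ a b → - (a - b) ≡ b - a
    flip = solve-∀

  ≡[mod]-trans : ∀ {a b c} → a ≡ b [mod m ] → b ≡ c [mod m ] → a ≡ c [mod m ]
  ≡[mod]-trans {a} {b} {c} (congruent a≡b) (congruent b≡c) =
    congruent (subst (m ∣_) (telescope a b c) (∣m∣n⇒∣m+n a≡b b≡c))
    where
    telescope : ∀ a b c → (a - b) + (b - c) ≡ a - c
    telescope = solve-∀

  +-cong[mod] : ∀ {a b c d} → a ≡ b [mod m ] → c ≡ d [mod m ] → a + c ≡ b + d [mod m ]
  +-cong[mod] {a} {b} {c} {d} (congruent a≡b) (congruent c≡d) =
    congruent (subst (m ∣_) (regroup a b c d) (∣m∣n⇒∣m+n a≡b c≡d))
    where
    regroup : ∀ a b c d → (a - b) + (c - d) ≡ (a + c) - (b + d)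
    regroup = solve-∀

  -‿cong[mod] : ∀ {a b} → a ≡ b [mod m ] → - a ≡ - b [mod m ]
  -‿cong[mod] {a} {b} (congruent a≡b) = congruent (subst (m ∣_) (neg-distrib a b) (∣m⇒∣-m a≡b))
    where
    neg-distrib : ∀ a b → - (a - b) ≡ - a - - b
    neg-distrib = solve-∀

  *-cong[mod] : ∀ {a b c d} → a ≡ b [mod m ] → c ≡ d [mod m ] → a * c ≡ b * d [mod m ]
  *-cong[mod] {a} {b} {c} {d} (congruent a≡b) (congruent c≡d) =
    congruent (subst (m ∣_) (split a b c d) (∣m∣n⇒∣m+n (∣n⇒∣m*n a c≡d) (∣m⇒∣m*n d a≡b)))
    where
    split : ∀ a b c d → a * (c - d) + (a - b) * d ≡ a * c - b * d
    split = solve-∀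

≡[mod]-setoid : ℤ → Setoid 0ℓ 0ℓ
≡[mod]-setoid m = record
  { Carrier       = ℤ
  ; _≈_           = _≡_[mod m ]
  ; isEquivalence = record { refl = ≡[mod]-refl ; sym = ≡[mod]-sym ; trans = ≡[mod]-trans }
  }

module ≡[mod]-Reasoning (m : ℤ) = SetoidReasoning (≡[mod]-setoid m)

*-congˡ[mod] : ∀ {m} c {a b} → a ≡ b [mod m ] → c * a ≡ c * b [mod m ]
*-congˡ[mod] c = *-cong[mod] (≡[mod]-refl {a = c})

*-congʳ[mod] : ∀ {m} c {a b} → a ≡ b [mod m ] → a * c ≡ b * c [mod m ]
*-congʳ[mod] c a≡b = *-cong[mod] a≡b (≡[mod]-refl {a = c})

≡0[mod]⇒∣ : ∀ {m x} → x ≡ 0ℤ [mod m ] → m ∣ x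
≡0[mod]⇒∣ {m} {x} (congruent m∣x-0) = subst (m ∣_) (ℤ.+-identityʳ x) m∣x-0

∣⇒≡0[mod] : ∀ {m x} → m ∣ x → x ≡ 0ℤ [mod m ]
∣⇒≡0[mod] {m} {x} m∣x = congruent (subst (m ∣_) (sym (ℤ.+-identityʳ x)) m∣x)

a≡a%ℕm[mod] : ∀ a m .{{_ : NonZero m}} → a ≡ + (a %ℕ m) [mod + m ]
a≡a%ℕm[mod] a m = congruent (divides (a /ℕ m) (begin
  a - + (a %ℕ m)                              ≡⟨ cong (_- + (a %ℕ m)) (a≡a%ℕn+[a/ℕn]*n a m) ⟩
  + (a %ℕ m) + (a /ℕ m) * + m - + (a %ℕ m)    ≡⟨ cancel (+ (a %ℕ m)) ((a /ℕ m) * + m) ⟩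
  (a /ℕ m) * + m                              ∎))
  where
  open ≡-Reasoning
  cancel : ∀ r x → r + x - r ≡ x
  cancel = solve-∀

small-multiple≡0 : ∀ {m d} → m ℕ.∣ d → d ℕ.< m → d ≡ 0
small-multiple≡0 {d = zero}  _   _   = refl
small-multiple≡0 {d = suc _} m∣d d<m = ⊥-elim (ℕ.>⇒∤ d<m m∣d)

<-≡[mod]⇒≡ : ∀ {m r s} → r ℕ.< m → s ℕ.< m → + r ≡ + s [mod + m ] → r ≡ s
<-≡[mod]⇒≡ {m} {r} {s} r<m s<m r≡s = ℤ.+-injective (ℤ.i-j≡0⇒i≡j (+ r) (+ s) (ℤ.∣i∣≡0⇒i≡0 ∣r-s∣≡0))
  where
  ∣r-s∣<m : ℤ.∣ + r - + s ∣ ℕ.< m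
  ∣r-s∣<m = subst (ℕ._< m) (cong ℤ.∣_∣ (sym (ℤ.[+m]-[+n]≡m⊖n r s)))
              (ℕ.≤-<-trans (ℤ.∣m⊝n∣≤m⊔n r s) (ℕ.⊔-lub r<m s<m))
  ∣r-s∣≡0 : ℤ.∣ + r - + s ∣ ≡ 0
  ∣r-s∣≡0 = small-multiple≡0 (∣⇒∣ᵤ (_≡_[mod_].m∣a-b r≡s)) ∣r-s∣<m

lift-reduce : ∀ n a → lift (reduce n a) ≡ a [mod + mod n ]
lift-reduce n a = ≡[mod]-trans
  (≡[mod]-reflexive (cong +_ (Fin.toℕ-fromℕ< (n%ℕd<d a (mod n) {{mod-nonZero n}}))))
  (≡[mod]-sym (a≡a%ℕm[mod] a (mod n) {{mod-nonZero n}}))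

reduce-cong : ∀ n {a b} → a ≡ b [mod + mod n ] → reduce n a ≡ reduce n b
reduce-cong n {a} {b} a≡b = cong ⟨_⟩ (Fin.toℕ-injective (<-≡[mod]⇒≡
  (Fin.toℕ<n (val (reduce n a))) (Fin.toℕ<n (val (reduce n b)))
  (≡[mod]-trans (lift-reduce n a) (≡[mod]-trans a≡b (≡[mod]-sym (lift-reduce n b))))))

reduce-injective : ∀ n a b → reduce n a ≡ reduce n b → a ≡ b [mod + mod n ]
reduce-injective n a b eq = ≡[mod]-trans (≡[mod]-sym (lift-reduce n a))
  (subst (λ x → lift x ≡ b [mod + mod n ]) (sym eq) (lift-reduce n b))

reduce-lift : ∀ {n} (x : Zmod n) → reduce n (lift x) ≡ x
reduce-lift {n} x = cong ⟨_⟩ (Fin.toℕ-injective (<-≡[mod]⇒≡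
  (Fin.toℕ<n (val (reduce n (lift x)))) (Fin.toℕ<n (val x)) (lift-reduce n (lift x))))

+mod-suc : ∀ k → + mod (suc k) ≡ + 2 * + mod k
+mod-suc k = ℤ.pos-* 2 (mod k)

+mod-sucʳ : ∀ k → + mod k * + 2 ≡ + mod (suc k)
+mod-sucʳ k = trans (ℤ.*-comm (+ mod k) (+ 2)) (sym (+mod-suc k))

parity : ∀ a → a ≡ 0ℤ [mod + 2 ] ⊎ a ≡ 1ℤ [mod + 2 ]
parity a = classify (a %ℕ 2) (n%ℕd<d a 2) (a≡a%ℕm[mod] a 2)
  where
  classify : ∀ r → r ℕ.< 2 → a ≡ + r [mod + 2 ] → a ≡ 0ℤ [mod + 2 ] ⊎ a ≡ 1ℤ [mod + 2 ]
  classify 0 _ a≡0 = inj₁ a≡0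
  classify 1 _ a≡1 = inj₂ a≡1
  classify (suc (suc _)) (s≤s (s≤s ()))

1≢0[mod2] : ¬ (1ℤ ≡ 0ℤ [mod + 2 ])
1≢0[mod2] 1≡0 with <-≡[mod]⇒≡ {2} {1} {0} (s≤s (s≤s z≤n)) (s≤s z≤n) 1≡0
... | ()

square-≡1 : ∀ r {x} → x ≡ 1ℤ [mod + 2 * r ] → x * x ≡ 1ℤ [mod + 2 * (+ 2 * r) ]
square-≡1 r {x} (congruent (divides q x-1≡q2r)) = congruent (divides (q * q * r + q) (begin
  x * x - 1ℤ                                ≡⟨ expand x ⟩
  (x - 1ℤ) * (x - 1ℤ) + + 2 * (x - 1ℤ)      ≡⟨ cong (λ t → t * t + + 2 * t) x-1≡q2r ⟩
  (q * (+ 2 * r)) * (q * (+ 2 * r)) + + 2 * (q * (+ 2 * r)) ≡⟨ collect q r ⟩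
  (q * q * r + q) * (+ 2 * (+ 2 * r))       ∎))
  where
  open ≡-Reasoning
  expand : ∀ x → x * x - 1ℤ ≡ (x - 1ℤ) * (x - 1ℤ) + + 2 * (x - 1ℤ)
  expand = solve-∀
  collect : ∀ q r → (q * (+ 2 * r)) * (q * (+ 2 * r)) + + 2 * (q * (+ 2 * r)) ≡ (q * q * r + q) * (+ 2 * (+ 2 * r))
  collect = solve-∀

odd⇒invertible : ∀ {a} → a ≡ 1ℤ [mod + 2 ] → ∀ k → ∃ λ u → a * u ≡ 1ℤ [mod + mod k ]
odd⇒invertible {a} _   zero          = 1ℤ , congruent (divides (a * 1ℤ - 1ℤ) (sym (ℤ.*-identityʳ _)))
odd⇒invertible {a} odd (suc zero)    = 1ℤ , subst (_≡ 1ℤ [mod + 2 ]) (sym (ℤ.*-identityʳ a)) odd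
odd⇒invertible {a} odd (suc (suc k)) with odd⇒invertible odd (suc k)
... | u , au≡1 = u * (a * u) , subst₂ (λ x m → x ≡ 1ℤ [mod m ]) (regroup a u) (sym modulus)
                                       (square-≡1 (+ mod k) (subst (λ m → a * u ≡ 1ℤ [mod m ]) (+mod-suc k) au≡1))
  where
  regroup : ∀ a u → (a * u) * (a * u) ≡ a * (u * (a * u))
  regroup = solve-∀
  modulus : + mod (suc (suc k)) ≡ + 2 * (+ 2 * + mod k)
  modulus = trans (+mod-suc (suc k)) (cong (+ 2 *_) (+mod-suc k))

even⇒half-modulus-annihilates : ∀ m {a} → a ≡ 0ℤ [mod + 2 ] → + mod m * a ≡ 0ℤ [mod + mod (suc m) ]
even⇒half-modulus-annihilates m {a} even = ∣⇒≡0[mod] (subst (_∣ + mod m * a) (+mod-sucʳ m) (*-monoʳ-∣ (+ mod m) (≡0[mod]⇒∣ even)))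

half-modulus-annihilates⇒even : ∀ m {a} → + mod m * a ≡ 0ℤ [mod + mod (suc m) ] → a ≡ 0ℤ [mod + 2 ]
half-modulus-annihilates⇒even m {a} ann =
  ∣⇒≡0[mod] (*-cancelˡ-∣ (+ mod m) {{mod-nonZero m}} (subst (_∣ + mod m * a) (sym (+mod-sucʳ m)) (≡0[mod]⇒∣ ann)))

unit⇒¬zero-divisor : ∀ {n} (a : Zmod n) → IsUnitᶻ a → ¬ IsZeroDivisorᶻ a
unit⇒¬zero-divisor {n} a (b , ab≡1) (c , c≢0 , ac≡0) =
  c≢0 (trans (sym (reduce-lift c)) (reduce-cong n c≡0))
  where
  open ≡[mod]-Reasoning (+ mod n)
  regroup : ∀ a b c → c * (a * b) ≡ (a * c) * b
  regroup = solve-∀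
  c≡0 : lift c ≡ 0ℤ [mod + mod n ]
  c≡0 = begin
    lift c                     ≡⟨ ℤ.*-identityʳ (lift c) ⟨
    lift c * 1ℤ                ≈⟨ *-congˡ[mod] (lift c) (reduce-injective n (lift a * lift b) 1ℤ ab≡1) ⟨
    lift c * (lift a * lift b) ≡⟨ regroup (lift a) (lift b) (lift c) ⟩
    (lift a * lift c) * lift b ≈⟨ *-congʳ[mod] (lift b) (reduce-injective n (lift a * lift c) 0ℤ ac≡0) ⟩
    0ℤ * lift b                ≡⟨ ℤ.*-zeroˡ (lift b) ⟩
    0ℤ                         ∎

odd⇒unit : ∀ {n} (a : Zmod n) → lift a ≡ 1ℤ [mod + 2 ] → IsUnitᶻ a
odd⇒unit {n} a odd with odd⇒invertible odd n
... | u , au≡1 = reduce n u , reduce-cong n (≡[mod]-trans (*-congˡ[mod] (lift a) (lift-reduce n u)) au≡1)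

half-modulus≢0 : ∀ m → reduce (suc m) (+ mod m) ≢ 0ᶻ
half-modulus≢0 m eq = 1≢0[mod2] (half-modulus-annihilates⇒even m
  (subst (_≡ 0ℤ [mod + mod (suc m) ]) (sym (ℤ.*-identityʳ (+ mod m))) (reduce-injective (suc m) (+ mod m) 0ℤ eq)))

even⇒zero-divisor : ∀ {m} (a : Zmod (suc m)) → lift a ≡ 0ℤ [mod + 2 ] → IsZeroDivisorᶻ a
even⇒zero-divisor {m} a even = reduce (suc m) (+ mod m) , half-modulus≢0 m , reduce-cong (suc m) (begin
  lift a * lift (reduce (suc m) (+ mod m)) ≈⟨ *-congˡ[mod] (lift a) (lift-reduce (suc m) (+ mod m)) ⟩
  lift a * + mod m                         ≡⟨ ℤ.*-comm (lift a) (+ mod m) ⟩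
  + mod m * lift a                         ≈⟨ even⇒half-modulus-annihilates m even ⟩
  0ℤ                                       ∎)
  where open ≡[mod]-Reasoning (+ mod (suc m))

unit-or-zero-divisor : ∀ {m} (a : Zmod (suc m)) → IsUnitᶻ a ⊎ IsZeroDivisorᶻ a
unit-or-zero-divisor a with parity (lift a)
... | inj₁ even = inj₂ (even⇒zero-divisor a even)
... | inj₂ odd  = inj₁ (odd⇒unit a odd)

unit⇒odd : ∀ {m} (a : Zmod (suc m)) → IsUnitᶻ a → lift a ≡ 1ℤ [mod + 2 ]
unit⇒odd a unit with parity (lift a)
... | inj₁ even = ⊥-elim (unit⇒¬zero-divisor a unit (even⇒zero-divisor a even))
... | inj₂ odd  = odd

zero-divisor⇒even : ∀ {m} (a : Zmod (suc m)) → IsZeroDivisorᶻ a → lift a ≡ 0ℤ [mod + 2 ]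
zero-divisor⇒even a zero-divisor with parity (lift a)
... | inj₁ even = even
... | inj₂ odd  = ⊥-elim (unit⇒¬zero-divisor a (odd⇒unit a odd) zero-divisor)

-- Integer quaternions, of which ℍ n is the coordinatewise reduction modulo 2^n.
record ℍℤ : Set where
  constructor quatℤ
  field re im₁ im₂ im₃ : ℤ
open ℍℤ

infixl 7 _·_
infixr 8 _⋆_

_·_ : ℍℤ → ℍℤ → ℍℤ
quatℤ a c e g · quatℤ b d f h =
  quatℤ (a * b - c * d - e * f - g * h)
        (a * d + c * b + e * h - g * f)
        (a * f - c * h + e * b + g * d)
        (a * h + c * f - e * d + g * b)

_⋆_ : ℤ → ℍℤ → ℍℤ
w ⋆ quatℤ a b c d = quatℤ (w * a) (w * b) (w * c) (w * d)

conj : ℍℤ → ℍℤ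
conj (quatℤ a b c d) = quatℤ a (- b) (- c) (- d)

scalar : ℤ → ℍℤ
scalar a = quatℤ a 0ℤ 0ℤ 0ℤ

norm : ℍℤ → ℤ
norm (quatℤ a b c d) = a * a + b * b + c * c + d * d

ℍℤ-≡ : ∀ {X Y} → re X ≡ re Y → im₁ X ≡ im₁ Y → im₂ X ≡ im₂ Y → im₃ X ≡ im₃ Y → X ≡ Y
ℍℤ-≡ refl refl refl refl = refl

·-scalarʳ : ∀ X w → X · scalar w ≡ w ⋆ X
·-scalarʳ X w = ℍℤ-≡ (e₁ a b c d w) (e₂ a b c d w) (e₃ a b c d w) (e₄ a b c d w)
  where
  a b c d : ℤ
  a = re X ; b = im₁ X ; c = im₂ X ; d = im₃ X
  e₁ : ∀ a b c d w → a * w - b * 0ℤ - c * 0ℤ - d * 0ℤ ≡ w * a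
  e₁ = solve-∀
  e₂ : ∀ a b c d w → a * 0ℤ + b * w + c * 0ℤ - d * 0ℤ ≡ w * b
  e₂ = solve-∀
  e₃ : ∀ a b c d w → a * 0ℤ - b * 0ℤ + c * w + d * 0ℤ ≡ w * c
  e₃ = solve-∀
  e₄ : ∀ a b c d w → a * 0ℤ + b * 0ℤ - c * 0ℤ + d * w ≡ w * d
  e₄ = solve-∀

·-conj-scaleʳ : ∀ w X → X · conj (w ⋆ X) ≡ scalar (w * norm X)
·-conj-scaleʳ w X = ℍℤ-≡ (e₁ w a b c d) (e₂ w a b c d) (e₃ w a b c d) (e₄ w a b c d)
  where
  a b c d : ℤ
  a = re X ; b = im₁ X ; c = im₂ X ; d = im₃ X
  e₁ : ∀ w a b c d → a * (w * a) - b * - (w * b) - c * - (w * c) - d * - (w * d) ≡ w * (a * a + b * b + c * c + d * d)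
  e₁ = solve-∀
  e₂ : ∀ w a b c d → a * - (w * b) + b * (w * a) + c * - (w * d) - d * - (w * c) ≡ 0ℤ
  e₂ = solve-∀
  e₃ : ∀ w a b c d → a * - (w * c) - b * - (w * d) + c * (w * a) + d * - (w * b) ≡ 0ℤ
  e₃ = solve-∀
  e₄ : ∀ w a b c d → a * - (w * d) + b * - (w * c) - c * - (w * b) + d * (w * a) ≡ 0ℤ
  e₄ = solve-∀

conj-scale-·ˡ : ∀ w X → conj (w ⋆ X) · X ≡ scalar (w * norm X)
conj-scale-·ˡ w X = ℍℤ-≡ (e₁ w a b c d) (e₂ w a b c d) (e₃ w a b c d) (e₄ w a b c d)
  where
  a b c d : ℤ
  a = re X ; b = im₁ X ; c = im₂ X ; d = im₃ X
  e₁ : ∀ w a b c d → w * a * a - - (w * b) * b - - (w * c) * c - - (w * d) * d ≡ w * (a * a + b * b + c * c + d * d)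
  e₁ = solve-∀
  e₂ : ∀ w a b c d → w * a * b + - (w * b) * a + - (w * c) * d - - (w * d) * c ≡ 0ℤ
  e₂ = solve-∀
  e₃ : ∀ w a b c d → w * a * c - - (w * b) * d + - (w * c) * a + - (w * d) * b ≡ 0ℤ
  e₃ = solve-∀
  e₄ : ∀ w a b c d → w * a * d + - (w * b) * c - - (w * c) * b + - (w * d) * a ≡ 0ℤ
  e₄ = solve-∀

infix 4 _≈ᴴ_[mod_]

record _≈ᴴ_[mod_] (X Y : ℍℤ) (m : ℤ) : Set where
  constructor componentwise
  field
    re≡  : re X ≡ re Y [mod m ]
    im₁≡ : im₁ X ≡ im₁ Y [mod m ]
    im₂≡ : im₂ X ≡ im₂ Y [mod m ]
    im₃≡ : im₃ X ≡ im₃ Y [mod m ]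

≈ᴴ-refl : ∀ {m X} → X ≈ᴴ X [mod m ]
≈ᴴ-refl = componentwise ≡[mod]-refl ≡[mod]-refl ≡[mod]-refl ≡[mod]-refl

·-cong[mod] : ∀ {m X X′ Y Y′} → X ≈ᴴ X′ [mod m ] → Y ≈ᴴ Y′ [mod m ] → X · Y ≈ᴴ X′ · Y′ [mod m ]
·-cong[mod] {m} (componentwise a c e g) (componentwise b d f h) = componentwise
  (a ⊗ b ⊖ c ⊗ d ⊖ e ⊗ f ⊖ g ⊗ h)
  (a ⊗ d ⊕ c ⊗ b ⊕ e ⊗ h ⊖ g ⊗ f)
  (a ⊗ f ⊖ c ⊗ h ⊕ e ⊗ b ⊕ g ⊗ d)
  (a ⊗ h ⊕ c ⊗ f ⊖ e ⊗ d ⊕ g ⊗ b)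
  where
  infixl 6 _⊕_ _⊖_
  infixl 7 _⊗_
  _⊕_ : ∀ {x x′ y y′} → x ≡ x′ [mod m ] → y ≡ y′ [mod m ] → x + y ≡ x′ + y′ [mod m ]
  p ⊕ q = +-cong[mod] p q
  _⊖_ : ∀ {x x′ y y′} → x ≡ x′ [mod m ] → y ≡ y′ [mod m ] → x - y ≡ x′ - y′ [mod m ]
  p ⊖ q = +-cong[mod] p (-‿cong[mod] q)
  _⊗_ : ∀ {x x′ y y′} → x ≡ x′ [mod m ] → y ≡ y′ [mod m ] → x * y ≡ x′ * y′ [mod m ]
  p ⊗ q = *-cong[mod] p q

liftᴴ : ∀ {n} → ℍ n → ℍℤ
liftᴴ (quat a b c d) = quatℤ (lift a) (lift b) (lift c) (lift d)

reduceᴴ : ∀ n → ℍℤ → ℍ n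
reduceᴴ n (quatℤ a b c d) = quat (reduce n a) (reduce n b) (reduce n c) (reduce n d)

ℍ-≡ : ∀ {n} {x y : ℍ n} → a₁ x ≡ a₁ y → a₂ x ≡ a₂ y → a₃ x ≡ a₃ y → a₄ x ≡ a₄ y → x ≡ y
ℍ-≡ refl refl refl refl = refl

module _ (n : ℕ) where

  reduceᴴ-cong : ∀ {X Y} → X ≈ᴴ Y [mod + mod n ] → reduceᴴ n X ≡ reduceᴴ n Y
  reduceᴴ-cong (componentwise p q r s) = ℍ-≡ (reduce-cong n p) (reduce-cong n q) (reduce-cong n r) (reduce-cong n s)

  reduceᴴ-injective : ∀ X Y → reduceᴴ n X ≡ reduceᴴ n Y → X ≈ᴴ Y [mod + mod n ]
  reduceᴴ-injective X Y eq = componentwise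
    (reduce-injective n (re X) (re Y) (cong a₁ eq)) (reduce-injective n (im₁ X) (im₁ Y) (cong a₂ eq))
    (reduce-injective n (im₂ X) (im₂ Y) (cong a₃ eq)) (reduce-injective n (im₃ X) (im₃ Y) (cong a₄ eq))

  liftᴴ-reduceᴴ : ∀ X → liftᴴ (reduceᴴ n X) ≈ᴴ X [mod + mod n ]
  liftᴴ-reduceᴴ X = componentwise (lift-reduce n (re X)) (lift-reduce n (im₁ X)) (lift-reduce n (im₂ X)) (lift-reduce n (im₃ X))

  -- x *ᴴ y is by definition reduceᴴ n (liftᴴ x · liftᴴ y).
  *ᴴ-reduceᴴʳ : ∀ (x : ℍ n) Y → x *ᴴ reduceᴴ n Y ≡ reduceᴴ n (liftᴴ x · Y)
  *ᴴ-reduceᴴʳ x Y = reduceᴴ-cong (·-cong[mod] (≈ᴴ-refl {X = liftᴴ x}) (liftᴴ-reduceᴴ Y))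

  *ᴴ-reduceᴴˡ : ∀ Y (x : ℍ n) → reduceᴴ n Y *ᴴ x ≡ reduceᴴ n (Y · liftᴴ x)
  *ᴴ-reduceᴴˡ Y x = reduceᴴ-cong (·-cong[mod] (liftᴴ-reduceᴴ Y) (≈ᴴ-refl {X = liftᴴ x}))

  reduceᴴ-scalar-cong : ∀ {a b} → a ≡ b [mod + mod n ] → reduceᴴ n (scalar a) ≡ reduceᴴ n (scalar b)
  reduceᴴ-scalar-cong a≡b = cong (λ z → quat z 0ᶻ 0ᶻ 0ᶻ) (reduce-cong n a≡b)

_≟ᶻ_ : ∀ {n} → DecidableEquality (Zmod n)
⟨ a ⟩ ≟ᶻ ⟨ b ⟩ = map′ (cong ⟨_⟩) (cong val) (a Fin.≟ b)

_≟ᴴ_ : ∀ {n} → DecidableEquality (ℍ n)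
x ≟ᴴ y = map′ (λ (p , q , r , s) → ℍ-≡ p q r s) (λ x≡y → cong a₁ x≡y , cong a₂ x≡y , cong a₃ x≡y , cong a₄ x≡y)
  (a₁ x ≟ᶻ a₁ y ×-dec a₂ x ≟ᶻ a₂ y ×-dec a₃ x ≟ᶻ a₃ y ×-dec a₄ x ≟ᶻ a₄ y)

odd-norm⇒unit : ∀ {n} (q : ℍ n) → norm (liftᴴ q) ≡ 1ℤ [mod + 2 ] → IsUnitᴴ q
odd-norm⇒unit {n} q odd with odd⇒invertible odd n
... | u , Nu≡1 = y , (begin
    q *ᴴ y                            ≡⟨ *ᴴ-reduceᴴʳ n q (conj (u ⋆ Q)) ⟩
    reduceᴴ n (Q · conj (u ⋆ Q))      ≡⟨ cong (reduceᴴ n) (·-conj-scaleʳ u Q) ⟩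
    reduceᴴ n (scalar (u * norm Q))   ≡⟨ reduceᴴ-scalar-cong n uN≡1 ⟩
    1ᴴ                                ∎)
  , (begin
    y *ᴴ q                            ≡⟨ *ᴴ-reduceᴴˡ n (conj (u ⋆ Q)) q ⟩
    reduceᴴ n (conj (u ⋆ Q) · Q)      ≡⟨ cong (reduceᴴ n) (conj-scale-·ˡ u Q) ⟩
    reduceᴴ n (scalar (u * norm Q))   ≡⟨ reduceᴴ-scalar-cong n uN≡1 ⟩
    1ᴴ                                ∎)
  where
  open ≡-Reasoning
  Q : ℍℤ
  Q = liftᴴ q
  y : ℍ n
  y = reduceᴴ n (conj (u ⋆ Q))
  uN≡1 : u * norm Q ≡ 1ℤ [mod + mod n ]
  uN≡1 = subst (_≡ 1ℤ [mod + mod n ]) (ℤ.*-comm (norm Q) u) Nu≡1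

conj-≈0 : ∀ {m} X → conj X ≈ᴴ scalar 0ℤ [mod m ] → X ≈ᴴ scalar 0ℤ [mod m ]
conj-≈0 X (componentwise p q r s) = componentwise p (-‿cancel q) (-‿cancel r) (-‿cancel s)
  where
  -‿cancel : ∀ {m x} → - x ≡ 0ℤ [mod m ] → x ≡ 0ℤ [mod m ]
  -‿cancel {x = x} -x≡0 = subst (_≡ 0ℤ [mod _ ]) (ℤ.neg-involutive x) (-‿cong[mod] -x≡0)

even-norm⇒zero-divisor : ∀ {m} (q : ℍ (suc m)) → norm (liftᴴ q) ≡ 0ℤ [mod + 2 ] → IsZeroDivisorᴴ q
even-norm⇒zero-divisor {m} q even = witness (reduceᴴ n (conj (w ⋆ Q)) ≟ᴴ 0ᴴ)
  where
  open ≡-Reasoning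
  n : ℕ
  n = suc m
  Q : ℍℤ
  Q = liftᴴ q
  w : ℤ
  w = + mod m
  witness : Dec (reduceᴴ n (conj (w ⋆ Q)) ≡ 0ᴴ) → IsZeroDivisorᴴ q
  witness (no y≢0) = reduceᴴ n (conj (w ⋆ Q)) , y≢0 , inj₁ (begin
    q *ᴴ reduceᴴ n (conj (w ⋆ Q))    ≡⟨ *ᴴ-reduceᴴʳ n q (conj (w ⋆ Q)) ⟩
    reduceᴴ n (Q · conj (w ⋆ Q))      ≡⟨ cong (reduceᴴ n) (·-conj-scaleʳ w Q) ⟩
    reduceᴴ n (scalar (w * norm Q))   ≡⟨ reduceᴴ-scalar-cong n (even⇒half-modulus-annihilates m even) ⟩
    0ᴴ                                ∎)
  witness (yes y≡0) = reduceᴴ n (scalar w) , (λ eq → half-modulus≢0 m (cong a₁ eq)) , inj₁ (begin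
    q *ᴴ reduceᴴ n (scalar w)    ≡⟨ *ᴴ-reduceᴴʳ n q (scalar w) ⟩
    reduceᴴ n (Q · scalar w)     ≡⟨ cong (reduceᴴ n) (·-scalarʳ Q w) ⟩
    reduceᴴ n (w ⋆ Q)            ≡⟨ reduceᴴ-cong n (conj-≈0 (w ⋆ Q) (reduceᴴ-injective n (conj (w ⋆ Q)) (scalar 0ℤ) y≡0)) ⟩
    0ᴴ                           ∎)

Separates : ∀ {k} → Subset k → (Fin k → Set) → (Fin k → Set) → Set
Separates S P Q = ∀ i → (i ∈ S → P i) × (i ∉ S → Q i)

module _ {k} {P Q : Fin (suc k) → Set} where

  separates-∷ : ∀ {x S} → (0F ∈ x ∷ S → P 0F) × (0F ∉ x ∷ S → Q 0F) →
                Separates S (P ∘ Fin.suc) (Q ∘ Fin.suc) → Separates (x ∷ S) P Q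
  separates-∷ head _    0F    = head
  separates-∷ _    tail (Fin.suc i) =
    (λ { (there i∈S) → proj₁ (tail i) i∈S }) , (λ i∉x∷S → proj₂ (tail i) (i∉x∷S ∘ there))

  separates-tail : ∀ {x S} → Separates (x ∷ S) P Q → Separates S (P ∘ Fin.suc) (Q ∘ Fin.suc)
  separates-tail sep i = (λ i∈S → proj₁ (sep (Fin.suc i)) (there i∈S))
                       , (λ i∉S → proj₂ (sep (Fin.suc i)) (λ { (there i∈S) → i∉S i∈S }))

separating-subset : ∀ {k} {P Q : Fin k → Set} → (∀ i → P i ⊎ Q i) → Σ (Subset k) λ S → Separates S P Q
separating-subset {zero}  _   = [] , λ ()
separating-subset {suc k} P⊎Q with separating-subset (P⊎Q ∘ Fin.suc) | P⊎Q 0F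
... | S , sep | inj₁ p = inside ∷ S  , separates-∷ ((λ _ → p) , λ 0∉ → ⊥-elim (0∉ here)) sep
... | S , sep | inj₂ q = outside ∷ S , separates-∷ ((λ ()) , λ _ → q) sep

separating-subset-unique : ∀ {k} {P Q : Fin k → Set} → (∀ i → P i → ¬ Q i) →
                           ∀ {S T} → Separates S P Q → Separates T P Q → S ≡ T
separating-subset-unique {zero}  _        {[]}    {[]}    _    _    = refl
separating-subset-unique {suc k} {P} {Q} disjoint {s ∷ S} {t ∷ T} sepS sepT =
  cong₂ _∷_ (same-side s t (sepS 0F) (sepT 0F))
            (separating-subset-unique (disjoint ∘ Fin.suc) (separates-tail sepS) (separates-tail sepT))
  where
  same-side : ∀ s t → (0F ∈ s ∷ S → P 0F) × (0F ∉ s ∷ S → Q 0F) →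
                      (0F ∈ t ∷ T → P 0F) × (0F ∉ t ∷ T → Q 0F) → s ≡ t
  same-side inside  inside  _       _       = refl
  same-side outside outside _       _       = refl
  same-side inside  outside (p , _) (_ , q) = ⊥-elim (disjoint 0F (p here) (q λ ()))
  same-side outside inside  (_ , q) (p , _) = ⊥-elim (disjoint 0F (p here) (q λ ()))

χ : Side → ℤ
χ inside  = 1ℤ
χ outside = 0ℤ

χ-idem : ∀ s → χ s * χ s ≡ χ s
χ-idem inside  = refl
χ-idem outside = refl

+∣p∣≡Σχ : ∀ {k} (p : Subset k) → + ∣ p ∣ ≡ foldr′ (λ s t → χ s + t) 0ℤ p
+∣p∣≡Σχ []            = refl
+∣p∣≡Σχ (inside  ∷ p) = cong (λ t → 1ℤ + t) (+∣p∣≡Σχ p)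
+∣p∣≡Σχ (outside ∷ p) = trans (+∣p∣≡Σχ p) (sym (ℤ.+-identityˡ _))

separated-parity : ∀ {m k} (S : Subset k) i (a : Zmod (suc m)) →
                   (i ∈ S → IsUnitᶻ a) × (i ∉ S → IsZeroDivisorᶻ a) → lift a ≡ χ (lookup S i) [mod + 2 ]
separated-parity S i a (unit , zero-divisor) with lookup S i in eq
... | inside  = unit⇒odd a (unit (lookup⇒[]= i S eq))
... | outside = zero-divisor⇒even a (zero-divisor λ i∈S → inside≢outside (trans (sym ([]=⇒lookup i∈S)) eq))
  where
  inside≢outside : inside ≢ outside
  inside≢outside ()

unit-count-parity : ∀ {m k} (q : ℍ (suc m)) → HasUnitCount q k → norm (liftᴴ q) ≡ + k [mod + 2 ]
unit-count-parity q (S@(s₁ ∷ s₂ ∷ s₃ ∷ s₄ ∷ []) , refl , sep) = begin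
  norm (liftᴴ q)                         ≈⟨ +-cong[mod] (+-cong[mod] (+-cong[mod] (square 0F) (square 1F)) (square 2F)) (square 3F) ⟩
  χ s₁ + χ s₂ + χ s₃ + χ s₄              ≡⟨ reassociate (χ s₁) (χ s₂) (χ s₃) (χ s₄) ⟩
  χ s₁ + (χ s₂ + (χ s₃ + (χ s₄ + 0ℤ)))   ≡⟨ +∣p∣≡Σχ S ⟨
  + ∣ S ∣                                ∎
  where
  open ≡[mod]-Reasoning (+ 2)
  square : ∀ i → lift (coord q i) * lift (coord q i) ≡ χ (lookup S i) [mod + 2 ]
  square i = subst (_ ≡_[mod + 2 ]) (χ-idem (lookup S i)) (*-cong[mod] parity-i parity-i)
    where
    parity-i : lift (coord q i) ≡ χ (lookup S i) [mod + 2 ]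
    parity-i = separated-parity S i (coord q i) (sep i)
  reassociate : ∀ a b c d → a + b + c + d ≡ a + (b + (c + (d + 0ℤ)))
  reassociate = solve-∀

unit-count⇒case : ∀ {n k} {q : ℍ n} → k ≤ 4 → HasUnitCount q k →
                  case-i q ⊎ case-ii q ⊎ case-iii q ⊎ case-iv q ⊎ case-v q
unit-count⇒case {k = 0} _ h = inj₁ h
unit-count⇒case {k = 1} _ h = inj₂ (inj₂ (inj₂ (inj₂ h)))
unit-count⇒case {k = 2} _ h = inj₂ (inj₂ (inj₁ h))
unit-count⇒case {k = 3} _ h = inj₂ (inj₂ (inj₂ (inj₁ h)))
unit-count⇒case {k = 4} _ h = inj₂ (inj₁ h)
unit-count⇒case {k = suc (suc (suc (suc (suc _))))} (s≤s (s≤s (s≤s (s≤s ())))) _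

theorem3p1 : (n : ℕ) → n ≥ 1 → (q : ℍ n) →
      (case-i q ⊎ case-ii q ⊎ case-iii q ⊎ case-iv q ⊎ case-v q)
    × ((k l : ℕ) → HasUnitCount q k → HasUnitCount q l → k ≡ l)
    × ((case-i q ⊎ case-ii q ⊎ case-iii q) → IsZeroDivisorᴴ q)
    × ((case-iv q ⊎ case-v q) → IsUnitᴴ q)
theorem3p1 zero    ()
theorem3p1 (suc m) _  q = exhaustive , unit-count-unique , zero-divisor-cases , unit-cases
  where
  units : Σ (Subset 4) λ S → Separates S (IsUnitᶻ ∘ coord q) (IsZeroDivisorᶻ ∘ coord q)
  units = separating-subset (λ i → unit-or-zero-divisor (coord q i))

  exhaustive : case-i q ⊎ case-ii q ⊎ case-iii q ⊎ case-iv q ⊎ case-v q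
  exhaustive = unit-count⇒case (∣p∣≤n (proj₁ units)) (proj₁ units , refl , proj₂ units)

  unit-count-unique : (k l : ℕ) → HasUnitCount q k → HasUnitCount q l → k ≡ l
  unit-count-unique _ _ (S , refl , sepS) (T , refl , sepT) =
    cong ∣_∣ (separating-subset-unique (λ i → unit⇒¬zero-divisor (coord q i)) sepS sepT)

  2≡0 : + 2 ≡ 0ℤ [mod + 2 ]
  2≡0 = congruent (divides (+ 1) refl)
  3≡1 : + 3 ≡ 1ℤ [mod + 2 ]
  3≡1 = congruent (divides (+ 1) refl)
  4≡0 : + 4 ≡ 0ℤ [mod + 2 ]
  4≡0 = congruent (divides (+ 2) refl)

  zero-divisor-cases : case-i q ⊎ case-ii q ⊎ case-iii q → IsZeroDivisorᴴ q
  zero-divisor-cases (inj₁ h)        = even-norm⇒zero-divisor q (unit-count-parity q h)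
  zero-divisor-cases (inj₂ (inj₁ h)) = even-norm⇒zero-divisor q (≡[mod]-trans (unit-count-parity q h) 4≡0)
  zero-divisor-cases (inj₂ (inj₂ h)) = even-norm⇒zero-divisor q (≡[mod]-trans (unit-count-parity q h) 2≡0)

  unit-cases : case-iv q ⊎ case-v q → IsUnitᴴ q
  unit-cases (inj₁ h) = odd-norm⇒unit q (≡[mod]-trans (unit-count-parity q h) 3≡1)
  unit-cases (inj₂ h) = odd-norm⇒unit q (unit-count-parity q h)
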